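{- Let $n$ be an even nonnegative integer, let $\mathbf{n}=\mathbf{n}_1\cdots\mathbf{n}_r$ be the block decomposition of its minimal hyperbinary expansion, let $(a_1,\ldots,a_r)$ be the lengths (as words) of the blocks $\mathbf{n}_1,\ldots,\mathbf{n}_r$, and let $(t_1,\ldots,t_r)\in\{1,2\}^r$ be their types. Define, for integers $\alpha,\beta,\sigma$, \[ b_1(\alpha,\beta,\sigma):=\alpha\beta+\sigma,\quad b_2(\alpha,\beta,\sigma):=\beta+\alpha\sigma,\quad s_1(\alpha,\beta,\sigma):=(\alpha-1)\beta+\sigma,\quad s_2(\alpha,\beta,\sigma):=\sigma. \] Define $h_0:=1$, $k_0:=1$, and for $i\in\{0,\ldots,r-1\}$, \[ h_{i+1}:=b_{t_{r-i}}(a_{r-i},h_i,k_i),\qquad k_{i+1}:=s_{t_{r-i}}(a_{r-i},h_i,k_i). \] Then $b(n)=h_r$.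
   Context: Let $\Sigma^*$ be the free monoid of finite words over the alphabet $\{0,1,2\}$ (including the empty word), with concatenation as product. A word $x_0x_1\cdots x_k\in\Sigma^*$ with $x_0\neq 0$ is a hyperbinary expansion of the nonnegative integer $\sum_{i=0}^k x_i2^{k-i}$; the empty word is the unique hyperbinary expansion of $0$. $b(n)$ denotes the number of hyperbinary expansions of $n$. The minimal hyperbinary expansion of $n$ is its unique hyperbinary expansion containing no digit $0$. A block of type $1$ is a word $1^t2=1\cdots12$ (length $t+1$) and a block of type $2$ is a word $2^t=2\cdots2$ (length $t$), for an integer $t\ge1$. The minimal hyperbinary expansion of an even number $n$ can be written in a unique way as a product $\mathbf{n}_1\cdots\mathbf{n}_r$ ($r\ge 0$; $r=0$ iff $n=0$) of blocks with no two consecutive blocks of type $2$; this is its block decomposition. -}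

module Defs where

open import Data.Nat as ℕ using (ℕ; zero; suc)
open import Data.Integer as ℤ using (ℤ; +_)
open import Data.List using (List; []; _∷_; _++_; foldl; foldr; replicate; concat; map)
open import Data.List.Relation.Unary.All using (All)
open import Data.Product using (_×_; _,_; proj₁)
open import Data.Unit using (⊤)
open import Relation.Binary.PropositionalEquality using (_≡_; _≢_)

data Digit : Set where
  d0 d1 d2 : Digit

digitVal : Digit → ℕ
digitVal d0 = 0
digitVal d1 = 1
digitVal d2 = 2

Word : Set
Word = List Digit

-- value Σ x_i 2^(k-i) of x_0 x_1 ... x_k (most significant digit first)
value : Word → ℕ
value = foldl (λ acc d → 2 ℕ.* acc ℕ.+ digitVal d) 0

LeadingNonzero : Word → Set
LeadingNonzero []      = ⊤
LeadingNonzero (x ∷ _) = x ≢ d0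

IsHyperbinary : ℕ → Word → Set
IsHyperbinary n w = LeadingNonzero w × value w ≡ n

NoZero : Word → Set
NoZero w = All (λ d → d ≢ d0) w

-- blocks: type 1 with parameter t is 1^t 2, type 2 with parameter t is 2^t  (t ≥ 1);
-- we store u = t - 1, so t = suc u
data Block : Set where
  type1 : ℕ → Block
  type2 : ℕ → Block

blockWord : Block → Word
blockWord (type1 u) = replicate (suc u) d1 ++ (d2 ∷ [])
blockWord (type2 u) = replicate (suc u) d2

blockLength : Block → ℕ
blockLength (type1 u) = suc (suc u)
blockLength (type2 u) = suc u

data NoConsecutiveType2 : List Block → Set where
  []  : NoConsecutiveType2 []
  [_] : ∀ b → NoConsecutiveType2 (b ∷ [])
  _∷1_ : ∀ {u b bs} → NoConsecutiveType2 (b ∷ bs) → NoConsecutiveType2 (type1 u ∷ b ∷ bs)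
  _∷2_ : ∀ {u v bs} → NoConsecutiveType2 (type1 v ∷ bs) → NoConsecutiveType2 (type2 u ∷ type1 v ∷ bs)

IsBlockDecomposition : ℕ → List Block → Set
IsBlockDecomposition n bs =
  IsHyperbinary n (concat (map blockWord bs)) × NoZero (concat (map blockWord bs)) × NoConsecutiveType2 bs

b₁ b₂ s₁ s₂ : ℤ → ℤ → ℤ → ℤ
b₁ α β σ = α ℤ.* β ℤ.+ σ
b₂ α β σ = β ℤ.+ α ℤ.* σ
s₁ α β σ = (α ℤ.- + 1) ℤ.* β ℤ.+ σ
s₂ α β σ = σ

step : Block → ℤ × ℤ → ℤ × ℤ
step B@(type1 _) (h , k) = b₁ (+ blockLength B) h k , s₁ (+ blockLength B) h k
step B@(type2 _) (h , k) = b₂ (+ blockLength B) h k , s₂ (+ blockLength B) h k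

-- (h_r , k_r) for blocks n_1 ⋯ n_r: start at (h_0,k_0)=(1,1), consume n_r first, n_1 last
hk : List Block → ℤ × ℤ
hk = foldr step (+ 1 , + 1)

h : List Block → ℤ
h bs = proj₁ (hk bs)

{-# OPTIONS --safe #-}
-- Splitting off the last digit gives b(2v+1) = b(v) and b(2v+2) = b(v) + b(v+1), and
-- lists of all expansions can be built along the same recursion.  Reading the minimal
-- expansion w of n from the left, the pair (b(v), b(v+1)) over the prefixes v of w thus
-- evolves by one linear map per digit, starting from (b(0), b(1)) = (1, 1).  Its first
-- entry is a linear form in the starting pair whose coefficients (α, β) come from applying
-- the transposed maps to (1, 0) while reading w from the right; over one block these
-- transposed maps compose to the recurrences b_t, s_t, with h = α + β and k = α.
module Submission where

open import Defs
open import Data.Nat using (ℕ; _*_)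
open import Data.Integer using (+_)
open import Data.List using (List; length)
open import Data.List.Membership.Propositional using (_∈_)
open import Data.List.Relation.Unary.Unique.Propositional using (Unique)
open import Data.Product using (Σ; _×_)
open import Function.Bundles using (_⇔_)
open import Relation.Binary.PropositionalEquality using (_≡_)

open import Data.Nat using (suc; _+_; _≤_)
open import Data.Nat.Properties
  using (+-comm; +-assoc; +-identityʳ; *-identityˡ; *-identityʳ; *-suc; +-cancelˡ-≡; *-cancelˡ-≡;
         even≢odd; m≤n*m; m≤m+n; ≤-refl; ≤-trans)
open import Data.Nat.Tactic.RingSolver using (solve-∀)
import Data.Integer as ℤ
open import Data.Integer.Properties using (pos-+; pos-*)
open import Data.List using ([]; _∷_; _++_; _∷ʳ_; map; foldl; foldr; replicate; concat)
open import Data.List.Properties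
  using (foldl-∷ʳ; foldr-∷ʳ; foldr-++; length-map; length-++; ∷ʳ-injectiveˡ; ∷ʳ-injectiveʳ)
open import Data.List.Reverse using (reverseView; []; _∶_∶ʳ_)
open import Data.List.Relation.Unary.All using ([]; _∷_)
open import Data.List.Relation.Unary.Any using (here)
import Data.List.Relation.Unary.AllPairs as AllPairs
import Data.List.Relation.Unary.Unique.Propositional.Properties as Unique
open import Data.List.Membership.Propositional.Properties
  using (∈-map⁺; ∈-map⁻; ∈-++⁺ˡ; ∈-++⁺ʳ; ∈-++⁻)
open import Data.Product using (_,_; proj₁; proj₂)
import Data.Product as Product
open import Data.Sum using (inj₁; inj₂)
open import Data.Unit using (tt)
open import Function.Base using (_∘_)
open import Function.Bundles using (mk⇔; module Equivalence)
open import Relation.Binary.PropositionalEquality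
  using (refl; sym; trans; cong; cong₂; subst; _≢_; module ≡-Reasoning)
open import Relation.Nullary using (¬_; contradiction)

valueFrom : ℕ → Word → ℕ
valueFrom = foldl (λ acc d → 2 * acc + digitVal d)

valueFrom-≥ : ∀ a w → a ≤ valueFrom a w
valueFrom-≥ a []      = ≤-refl
valueFrom-≥ a (d ∷ w) = ≤-trans (≤-trans (m≤n*m a 2) (m≤m+n (2 * a) (digitVal d))) (valueFrom-≥ _ w)

value-∷ʳ : ∀ u d → value (u ∷ʳ d) ≡ digitVal d + 2 * value u
value-∷ʳ u d = trans (foldl-∷ʳ _ 0 d u) (+-comm (2 * value u) (digitVal d))

leadingNonzero-∷ʳ⁻ : ∀ u d → LeadingNonzero (u ∷ʳ d) → LeadingNonzero u
leadingNonzero-∷ʳ⁻ []      _ _  = tt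
leadingNonzero-∷ʳ⁻ (_ ∷ _) _ ln = ln

hyperbinary-zero : ∀ {w} → IsHyperbinary 0 w → w ≡ []
hyperbinary-zero {[]}     _           = refl
hyperbinary-zero {d0 ∷ _} (d0≢d0 , _) = contradiction refl d0≢d0
hyperbinary-zero {d1 ∷ w} (_ , w≡0)   = contradiction (subst (1 ≤_) w≡0 (valueFrom-≥ 1 w)) λ ()
hyperbinary-zero {d2 ∷ w} (_ , w≡0)   = contradiction (subst (2 ≤_) w≡0 (valueFrom-≥ 2 w)) λ ()

hyperbinary-∷ʳ⁺ : ∀ {n} u d → (n ≡ 0 → d ≢ d0) → IsHyperbinary n u →
                  IsHyperbinary (digitVal d + 2 * n) (u ∷ʳ d)
hyperbinary-∷ʳ⁺ []        d d≢d0 (_  , refl) = d≢d0 refl , value-∷ʳ [] d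
hyperbinary-∷ʳ⁺ u@(_ ∷ _) d _    (ln , refl) = ln , value-∷ʳ u d

hyperbinary-∷ʳ-value : ∀ {N} u d → IsHyperbinary N (u ∷ʳ d) → digitVal d + 2 * value u ≡ N
hyperbinary-∷ʳ-value u d (_ , eq) = trans (sym (value-∷ʳ u d)) eq

hyperbinary-∷ʳ⁻ : ∀ {n} u d → IsHyperbinary (digitVal d + 2 * n) (u ∷ʳ d) → IsHyperbinary n u
hyperbinary-∷ʳ⁻ {n} u d hb@(ln , _) =
  leadingNonzero-∷ʳ⁻ u d ln ,
  *-cancelˡ-≡ (value u) n 2 (+-cancelˡ-≡ (digitVal d) _ _ (hyperbinary-∷ʳ-value u d hb))

odd⇒last-digit-1 : ∀ d a n → digitVal d + 2 * a ≡ 1 + 2 * n → d ≡ d1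
odd⇒last-digit-1 d0 a n eq = contradiction eq (even≢odd a n)
odd⇒last-digit-1 d1 _ _ _  = refl
odd⇒last-digit-1 d2 a n eq = contradiction (trans (*-suc 2 a) eq) (even≢odd (suc a) n)

even⇒last-digit≢1 : ∀ d a n → digitVal d + 2 * a ≡ 2 + 2 * n → d ≢ d1
even⇒last-digit≢1 d0 _ _ _  ()
even⇒last-digit≢1 d1 a n eq refl = even≢odd (suc n) a (trans (*-suc 2 n) (sym eq))
even⇒last-digit≢1 d2 _ _ _  ()

Enumerates : ℕ → List Word → Set
Enumerates n L = Unique L × (∀ w → w ∈ L ⇔ IsHyperbinary n w)

appendDigit : Digit → List Word → List Word
appendDigit d = map (_∷ʳ d)

appendDigit-unique : ∀ d {L} → Unique L → Unique (appendDigit d L)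
appendDigit-unique d = Unique.map⁺ λ {u} {v} → ∷ʳ-injectiveˡ u v

appendDigit-sound : ∀ {n L} d → (n ≡ 0 → d ≢ d0) → Enumerates n L →
                    ∀ {w} → w ∈ appendDigit d L → IsHyperbinary (digitVal d + 2 * n) w
appendDigit-sound d d≢d0 (_ , enum) w∈ with u , u∈L , refl ← ∈-map⁻ (_∷ʳ d) w∈ =
  hyperbinary-∷ʳ⁺ u d d≢d0 (Equivalence.to (enum u) u∈L)

appendDigit-complete : ∀ {n L} u d → Enumerates n L →
                       IsHyperbinary (digitVal d + 2 * n) (u ∷ʳ d) → u ∷ʳ d ∈ appendDigit d L
appendDigit-complete u d (_ , enum) hb =
  ∈-map⁺ (_∷ʳ d) (Equivalence.from (enum u) (hyperbinary-∷ʳ⁻ u d hb))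

enumerates-zero : Enumerates 0 ([] ∷ [])
enumerates-zero =
  [] AllPairs.∷ AllPairs.[] , λ w → mk⇔ (λ { (here refl) → tt , refl }) (here ∘ hyperbinary-zero)

enumerates-odd : ∀ {n L} → Enumerates n L → Enumerates (1 + 2 * n) (appendDigit d1 L)
enumerates-odd {n} {L} enum@(unique , _) =
  appendDigit-unique d1 unique , λ w → mk⇔ (appendDigit-sound d1 (λ _ ()) enum) (complete w)
  where
  complete : ∀ w → IsHyperbinary (1 + 2 * n) w → w ∈ appendDigit d1 L
  complete w hb with reverseView w
  ... | []         = contradiction (proj₂ hb) λ ()
  ... | u ∶ _ ∶ʳ d with refl ← odd⇒last-digit-1 d (value u) n (hyperbinary-∷ʳ-value u d hb) =
    appendDigit-complete u d1 enum hb

enumerates-even : ∀ {n L L′} → Enumerates n L → Enumerates (suc n) L′ →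
                  Enumerates (2 + 2 * n) (appendDigit d2 L ++ appendDigit d0 L′)
enumerates-even {n} {L} {L′} enum@(unique , _) enum′@(unique′ , _) =
  Unique.++⁺ (appendDigit-unique d2 unique) (appendDigit-unique d0 unique′) disjoint ,
  λ w → mk⇔ sound (complete w)
  where
  disjoint : ∀ {w} → ¬ (w ∈ appendDigit d2 L × w ∈ appendDigit d0 L′)
  disjoint (w∈ , w∈′)
    with u  , _ , refl ← ∈-map⁻ (_∷ʳ d2) w∈
    with u′ , _ , eq   ← ∈-map⁻ (_∷ʳ d0) w∈′
    with () ← ∷ʳ-injectiveʳ u u′ eq

  sound : ∀ {w} → w ∈ appendDigit d2 L ++ appendDigit d0 L′ → IsHyperbinary (2 + 2 * n) w
  sound {w} w∈ with ∈-++⁻ (appendDigit d2 L) w∈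
  ... | inj₁ w∈L  = appendDigit-sound d2 (λ _ ()) enum w∈L
  ... | inj₂ w∈L′ =
    subst (λ m → IsHyperbinary m w) (*-suc 2 n) (appendDigit-sound d0 (λ ()) enum′ w∈L′)

  complete : ∀ w → IsHyperbinary (2 + 2 * n) w → w ∈ appendDigit d2 L ++ appendDigit d0 L′
  complete w hb with reverseView w
  ... | []          = contradiction (proj₂ hb) λ ()
  ... | u ∶ _ ∶ʳ d0 = ∈-++⁺ʳ (appendDigit d2 L) (appendDigit-complete u d0 enum′
                        (subst (λ m → IsHyperbinary m (u ∷ʳ d0)) (sym (*-suc 2 n)) hb))
  ... | u ∶ _ ∶ʳ d1 = contradiction refl (even⇒last-digit≢1 d1 (value u) n (hyperbinary-∷ʳ-value u d1 hb))
  ... | u ∶ _ ∶ʳ d2 = ∈-++⁺ˡ (appendDigit-complete u d2 enum hb)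

EnumeratesPair : ℕ → List Word × List Word → Set
EnumeratesPair n (L , L′) = Enumerates n L × Enumerates (suc n) L′

-- The d0 clauses of expansionsStep and countStep are junk: d0 never occurs in a minimal expansion.
expansionsStep : List Word × List Word → Digit → List Word × List Word
expansionsStep p        d0 = p
expansionsStep (L , L′) d1 = appendDigit d1 L , appendDigit d2 L ++ appendDigit d0 L′
expansionsStep (L , L′) d2 = appendDigit d2 L ++ appendDigit d0 L′ , appendDigit d1 L′

enumeratesPair-step : ∀ {n p} d → d ≢ d0 → EnumeratesPair n p →
                      EnumeratesPair (digitVal d + 2 * n) (expansionsStep p d)
enumeratesPair-step d0 d0≢d0 _              = contradiction refl d0≢d0
enumeratesPair-step d1 _     (enum , enum′) = enumerates-odd enum , enumerates-even enum enum′
enumeratesPair-step {n} {p} d2 _ (enum , enum′) =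
  enumerates-even enum enum′ ,
  subst (λ m → Enumerates m (appendDigit d1 (proj₂ p))) (cong suc (*-suc 2 n)) (enumerates-odd enum′)

enumeratesPair-foldl : ∀ {n p} w → NoZero w → EnumeratesPair n p →
                       EnumeratesPair (valueFrom n w) (foldl expansionsStep p w)
enumeratesPair-foldl []      []              enum = enum
enumeratesPair-foldl {n} {p} (d ∷ w) (d≢d0 ∷ noZero) enum =
  enumeratesPair-foldl w noZero
    (subst (λ m → EnumeratesPair m (expansionsStep p d)) (+-comm (digitVal d) (2 * n))
           (enumeratesPair-step d d≢d0 enum))

expansions : Word → List Word × List Word
expansions = foldl expansionsStep ([] ∷ [] , appendDigit d1 ([] ∷ []))

expansions-enumerate : ∀ w → NoZero w → EnumeratesPair (value w) (expansions w)
expansions-enumerate w noZero =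
  enumeratesPair-foldl w noZero (enumerates-zero , enumerates-odd enumerates-zero)

countStep : ℕ × ℕ → Digit → ℕ × ℕ
countStep p       d0 = p
countStep (x , y) d1 = x , x + y
countStep (x , y) d2 = x + y , y

lengths : List Word × List Word → ℕ × ℕ
lengths = Product.map length length

length-appendDigit-++ : ∀ d e L L′ →
                        length (appendDigit d L ++ appendDigit e L′) ≡ length L + length L′
length-appendDigit-++ d e L L′ =
  trans (length-++ (appendDigit d L)) (cong₂ _+_ (length-map (_∷ʳ d) L) (length-map (_∷ʳ e) L′))

lengths-step : ∀ p d → lengths (expansionsStep p d) ≡ countStep (lengths p) d
lengths-step p        d0 = refl
lengths-step (L , L′) d1 = cong₂ _,_ (length-map (_∷ʳ d1) L) (length-appendDigit-++ d2 d0 L L′)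
lengths-step (L , L′) d2 = cong₂ _,_ (length-appendDigit-++ d2 d0 L L′) (length-map (_∷ʳ d1) L′)

lengths-foldl : ∀ p w → lengths (foldl expansionsStep p w) ≡ foldl countStep (lengths p) w
lengths-foldl p []      = refl
lengths-foldl p (d ∷ w) =
  trans (lengths-foldl (expansionsStep p d) w) (cong (λ q → foldl countStep q w) (lengths-step p d))

weightStep : Digit → ℕ × ℕ → ℕ × ℕ
weightStep d0 r       = r
weightStep d1 (α , β) = α + β , β
weightStep d2 (α , β) = α , α + β

weights : Word → ℕ × ℕ
weights = foldr weightStep (1 , 0)

infix 7 _·_
_·_ : ℕ × ℕ → ℕ × ℕ → ℕ
(α , β) · (x , y) = α * x + β * y

weightStep-transpose : ∀ d r s → weightStep d r · s ≡ r · countStep s d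
weightStep-transpose d0 r       s       = refl
weightStep-transpose d1 (α , β) (x , y) = lemma α β x y
  where
  lemma : ∀ α β x y → (α + β) * x + β * y ≡ α * x + β * (x + y)
  lemma = solve-∀
weightStep-transpose d2 (α , β) (x , y) = lemma α β x y
  where
  lemma : ∀ α β x y → α * x + (α + β) * y ≡ α * (x + y) + β * y
  lemma = solve-∀

proj₁-foldl-countStep : ∀ w s → proj₁ (foldl countStep s w) ≡ weights w · s
proj₁-foldl-countStep []      (x , y) = sym (trans (+-identityʳ (1 * x)) (*-identityˡ x))
proj₁-foldl-countStep (d ∷ w) s       =
  trans (proj₁-foldl-countStep w (countStep s d)) (sym (weightStep-transpose d (weights w) s))

foldr-weightStep-d1s : ∀ n α β → foldr weightStep (α , β) (replicate n d1) ≡ (n * β + α , β)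
foldr-weightStep-d1s 0       α β = refl
foldr-weightStep-d1s (suc n) α β =
  trans (cong (weightStep d1) (foldr-weightStep-d1s n α β))
        (cong (_, β) (trans (+-comm (n * β + α) β) (sym (+-assoc β (n * β) α))))

foldr-weightStep-d2s : ∀ n α β → foldr weightStep (α , β) (replicate n d2) ≡ (α , n * α + β)
foldr-weightStep-d2s 0       α β = refl
foldr-weightStep-d2s (suc n) α β =
  trans (cong (weightStep d2) (foldr-weightStep-d2s n α β)) (cong (α ,_) (sym (+-assoc α (n * α) β)))

b₁-pos : ∀ a h k → b₁ (+ a) (+ h) (+ k) ≡ + (a * h + k)
b₁-pos a h k = sym (trans (pos-+ (a * h) k) (cong (ℤ._+ + k) (pos-* a h)))

-- + suc a - + 1 reduces to + a, so s₁ (+ suc a) is b₁ (+ a) definitionally.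
s₁-pos : ∀ a h k → s₁ (+ suc a) (+ h) (+ k) ≡ + (a * h + k)
s₁-pos = b₁-pos

b₂-pos : ∀ a h k → b₂ (+ a) (+ h) (+ k) ≡ + (h + a * k)
b₂-pos a h k = sym (trans (pos-+ h (a * k)) (cong (ℤ._+_ (+ h)) (pos-* a k)))

toHK : ℕ × ℕ → ℤ.ℤ × ℤ.ℤ
toHK (α , β) = + (α + β) , + α

step-toHK : ∀ B r → step B (toHK r) ≡ toHK (foldr weightStep r (blockWord B))
step-toHK (type1 u) (α , β) = begin
  step (type1 u) (+ (α + β) , + α)
    ≡⟨ cong₂ _,_ (b₁-pos (suc t) (α + β) α) (s₁-pos t (α + β) α) ⟩
  + (suc t * (α + β) + α) , + (t * (α + β) + α)
    ≡⟨ cong (λ x → + x , + (t * (α + β) + α)) (lemma t (α + β) α) ⟩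
  toHK (t * (α + β) + α , α + β)
    ≡⟨ cong toHK (foldr-weightStep-d1s t α (α + β)) ⟨
  toHK (foldr weightStep (weightStep d2 (α , β)) (replicate t d1))
    ≡⟨ cong toHK (foldr-∷ʳ weightStep (α , β) d2 (replicate t d1)) ⟨
  toHK (foldr weightStep (α , β) (blockWord (type1 u)))
    ∎
  where
  open ≡-Reasoning
  t : ℕ
  t = suc u
  lemma : ∀ t h α → suc t * h + α ≡ t * h + α + h
  lemma = solve-∀
step-toHK (type2 u) (α , β) = begin
  step (type2 u) (+ (α + β) , + α)
    ≡⟨ cong (_, + α) (b₂-pos (suc u) (α + β) α) ⟩
  + (α + β + suc u * α) , + α
    ≡⟨ cong (λ x → + x , + α) (lemma (suc u) α β) ⟩
  toHK (α , suc u * α + β)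
    ≡⟨ cong toHK (foldr-weightStep-d2s (suc u) α β) ⟨
  toHK (foldr weightStep (α , β) (blockWord (type2 u)))
    ∎
  where
  open ≡-Reasoning
  lemma : ∀ a α β → α + β + a * α ≡ α + (a * α + β)
  lemma = solve-∀

blocksWord : List Block → Word
blocksWord bs = concat (map blockWord bs)

hk≡toHK-weights : ∀ bs → hk bs ≡ toHK (weights (blocksWord bs))
hk≡toHK-weights []       = refl
hk≡toHK-weights (B ∷ bs) = begin
  step B (hk bs)                                      ≡⟨ cong (step B) (hk≡toHK-weights bs) ⟩
  step B (toHK (weights (blocksWord bs)))             ≡⟨ step-toHK B (weights (blocksWord bs)) ⟩
  toHK (foldr weightStep (weights (blocksWord bs)) (blockWord B))
    ≡⟨ cong toHK (foldr-++ weightStep (1 , 0) (blockWord B) (blocksWord bs)) ⟨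
  toHK (weights (blocksWord (B ∷ bs)))                ∎
  where open ≡-Reasoning

mainTheorem6 : (m : ℕ) → (bs : List Block) → IsBlockDecomposition (2 * m) bs →
    Σ (List Word) (λ L → Unique L × (∀ w → (w ∈ L) ⇔ IsHyperbinary (2 * m) w)
    × + (length L) ≡ h bs)
mainTheorem6 m bs ((_ , value≡2m) , noZero , _) = L , proj₁ enum , proj₂ enum , count
  where
  open ≡-Reasoning
  w : Word
  w = blocksWord bs

  L : List Word
  L = proj₁ (expansions w)

  α β : ℕ
  α = proj₁ (weights w)
  β = proj₂ (weights w)

  enum : Enumerates (2 * m) L
  enum = subst (λ n → Enumerates n L) value≡2m (proj₁ (expansions-enumerate w noZero))

  count : + length L ≡ h bs
  count = begin
    + length L                          ≡⟨ cong (+_ ∘ proj₁) (lengths-foldl _ w) ⟩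
    + proj₁ (foldl countStep (1 , 1) w) ≡⟨ cong +_ (proj₁-foldl-countStep w (1 , 1)) ⟩
    + (weights w · (1 , 1))             ≡⟨ cong +_ (cong₂ _+_ (*-identityʳ α) (*-identityʳ β)) ⟩
    proj₁ (toHK (weights w))            ≡⟨ cong proj₁ (hk≡toHK-weights bs) ⟨
    h bs                                ∎
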